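{- Let $\mathbf h$ be a connected Hopf monoid in species. The set $\operatorname{supp}(\mathbf h)=\{n\in\mathbb{N}\mid \dim\mathbf h[n]\neq 0\}$ is a submonoid of $(\mathbb{N},+)$.
   Context: Base field $\mathbb{F}$ of arbitrary characteristic. Species are functors from finite sets and bijections to finite-dimensional $\mathbb{F}$-vector spaces; connected means $\mathbf h[\emptyset]=\mathbb{F}$; Hopf monoids are with respect to the Cauchy product; $\mathbf h[n]=\mathbf h[\{1,\dots,n\}]$. -}

module Defs where

open import Level using (Level; _⊔_)
open import Data.Nat using (ℕ; zero; suc)
import Data.Nat as ℕ
open import Data.Fin using (Fin; _≟_)
import Data.Fin as Fin
open import Data.Fin.Properties using (+↔⊎)
open import Data.Fin.Permutation using (Permutation′; _⟨$⟩ʳ_; _∘ₚ_)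
import Data.Fin.Permutation as Perm
import Data.Sum as Sum
open import Data.Sum using (_⊎_; inj₁; inj₂)
open import Data.Sum.Algebra using (⊎-assoc; ⊎-comm)
open import Data.Sum.Function.Propositional using (_⊎-↔_)
open import Data.Vec using (Vec; []; _∷_)
open import Data.Bool using (Bool; true; false)
open import Data.Product using (_×_; Σ; _,_)
open import Function.Bundles using (_↔_; Inverse; mk↔ₛ′)
open import Function.Properties.Inverse using (↔-refl; ↔-sym; ↔-trans)
open import Relation.Nullary using (¬_; does)
open import Relation.Binary.PropositionalEquality using (_≡_; refl)
open import Algebra.Bundles using (CommutativeRing)

record Field (c ℓ : Level) : Set (Level.suc (c ⊔ ℓ)) where
  field
    commutativeRing : CommutativeRing c ℓ
  open CommutativeRing commutativeRing public
  field
    1≉0     : ¬ (1# ≈ 0#)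
    inverse : ∀ x → ¬ (x ≈ 0#) → Σ Carrier (λ y → x * y ≈ 1#)

-- An ordered decomposition  I = S ⊔ T  of
-- I = Fin n with |S| = k, |T| = l is presented by a labelling bijection
--   τ : Fin k ⊎ Fin l ↔ Fin n      (S = τ(inj₁ _), T = τ(inj₂ _)).

Lab : ℕ → ℕ → ℕ → Set
Lab k l n = (Fin k ⊎ Fin l) ↔ Fin n

std : ∀ k l → Lab k l (k ℕ.+ l)
std k l = ↔-sym (+↔⊎ {k} {l})

unitˡ : ∀ n → Lab 0 n n
unitˡ n = std 0 n

unitʳ : ∀ n → Lab n 0 n
unitʳ n = mk↔ₛ′ to from invˡ invʳ
  where
  to : Fin n ⊎ Fin 0 → Fin n
  to (inj₁ i) = i
  to (inj₂ ())
  from : Fin n → Fin n ⊎ Fin 0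
  from i = inj₁ i
  invˡ : ∀ i → to (from i) ≡ i
  invˡ i = refl
  invʳ : ∀ x → from (to x) ≡ x
  invʳ (inj₁ i) = refl
  invʳ (inj₂ ())

mid : ∀ {a b c e} → ((Fin a ⊎ Fin c) ⊎ (Fin b ⊎ Fin e)) ↔ ((Fin a ⊎ Fin b) ⊎ (Fin c ⊎ Fin e))
mid {a} {b} {c} {e} = mk↔ₛ′ f g fg gf
  where
  f : (Fin a ⊎ Fin c) ⊎ (Fin b ⊎ Fin e) → (Fin a ⊎ Fin b) ⊎ (Fin c ⊎ Fin e)
  f (inj₁ (inj₁ x)) = inj₁ (inj₁ x)
  f (inj₁ (inj₂ x)) = inj₂ (inj₁ x)
  f (inj₂ (inj₁ x)) = inj₁ (inj₂ x)
  f (inj₂ (inj₂ x)) = inj₂ (inj₂ x)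
  g : (Fin a ⊎ Fin b) ⊎ (Fin c ⊎ Fin e) → (Fin a ⊎ Fin c) ⊎ (Fin b ⊎ Fin e)
  g (inj₁ (inj₁ x)) = inj₁ (inj₁ x)
  g (inj₁ (inj₂ x)) = inj₂ (inj₁ x)
  g (inj₂ (inj₁ x)) = inj₁ (inj₂ x)
  g (inj₂ (inj₂ x)) = inj₂ (inj₂ x)
  fg : ∀ y → f (g y) ≡ y
  fg (inj₁ (inj₁ x)) = refl
  fg (inj₁ (inj₂ x)) = refl
  fg (inj₂ (inj₁ x)) = refl
  fg (inj₂ (inj₂ x)) = refl
  gf : ∀ y → g (f y) ≡ y
  gf (inj₁ (inj₁ x)) = refl
  gf (inj₁ (inj₂ x)) = refl
  gf (inj₂ (inj₁ x)) = refl
  gf (inj₂ (inj₂ x)) = refl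

-- Every subset P ⊆ Fin n (a vector of booleans) gives the decomposition
-- Fin n = P ⊔ (complement of P), with a chosen labelling.
record Decomp (n : ℕ) : Set where
  constructor decomp
  field
    k l : ℕ
    lab : Lab k l n

extendˡ : ∀ {k l n} → Lab k l n → Lab (suc k) l (suc n)
extendˡ {k} {l} {n} τ =
  ↔-trans ((+↔⊎ {1} {k}) ⊎-↔ ↔-refl)
  (↔-trans (⊎-assoc _ (Fin 1) (Fin k) (Fin l))
  (↔-trans (↔-refl ⊎-↔ τ)
  (↔-sym (+↔⊎ {1} {n}))))

extendʳ : ∀ {k l n} → Lab k l n → Lab k (suc l) (suc n)
extendʳ {k} {l} {n} τ =
  ↔-trans (↔-refl ⊎-↔ (+↔⊎ {1} {l}))
  (↔-trans (↔-sym (⊎-assoc _ (Fin k) (Fin 1) (Fin l)))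
  (↔-trans (⊎-comm (Fin k) (Fin 1) ⊎-↔ ↔-refl)
  (↔-trans (⊎-assoc _ (Fin 1) (Fin k) (Fin l))
  (↔-trans (↔-refl ⊎-↔ τ)
  (↔-sym (+↔⊎ {1} {n}))))))

decompOf : ∀ {n} → Vec Bool n → Decomp n
decompOf []          = decomp 0 0 (mk↔ₛ′ (λ { (inj₁ ()) ; (inj₂ ()) }) (λ ()) (λ ()) (λ { (inj₁ ()) ; (inj₂ ()) }))
decompOf (true  ∷ P) with decompOf P
... | decomp k l τ = decomp (suc k) l (extendˡ τ)
decompOf (false ∷ P) with decompOf P
... | decomp k l τ = decomp k (suc l) (extendʳ τ)

assocL : ∀ {a b c n} → ((Fin a ⊎ (Fin b ⊎ Fin c)) ↔ Fin n) → Lab (a ℕ.+ b) c n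
assocL {a} {b} {c} θ = ↔-trans ((+↔⊎ {a} {b}) ⊎-↔ ↔-refl) (↔-trans (⊎-assoc _ (Fin a) (Fin b) (Fin c)) θ)

assocR : ∀ {a b c n} → ((Fin a ⊎ (Fin b ⊎ Fin c)) ↔ Fin n) → Lab a (b ℕ.+ c) n
assocR {a} {b} {c} θ = ↔-trans (↔-refl ⊎-↔ (+↔⊎ {b} {c})) θ

compat₁ : ∀ {a b c e n} → (((Fin a ⊎ Fin b) ⊎ (Fin c ⊎ Fin e)) ↔ Fin n) → Lab (a ℕ.+ b) (c ℕ.+ e) n
compat₁ {a} {b} {c} {e} θ = ↔-trans ((+↔⊎ {a} {b}) ⊎-↔ (+↔⊎ {c} {e})) θ

compat₂ : ∀ {a b c e n} → (((Fin a ⊎ Fin b) ⊎ (Fin c ⊎ Fin e)) ↔ Fin n) → Lab (a ℕ.+ c) (b ℕ.+ e) n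
compat₂ {a} {b} {c} {e} θ = ↔-trans ((+↔⊎ {a} {c}) ⊎-↔ (+↔⊎ {b} {e})) (↔-trans (mid {a} {b} {c} {e}) θ)

-- A species h is given on the finite sets [n] = Fin n (a skeleton of the
-- category of finite sets and bijections).  The vector space h[n] is
-- F^(dim n) (every finite-dimensional space is of this form), so vectors
-- are coordinate functions and linear maps are given by their matrices
-- (structure constants).  h[σ] for σ ∈ Aut(Fin n) is the matrix ρ σ.
-- The product / coproduct on a decomposition presented by a labelling
-- τ : Fin k ⊎ Fin l ↔ Fin n are
--   μ τ p i j  = coefficient of e_p in μ(e_i ⊗ e_j)
--   Δ τ i j p  = coefficient of e_i ⊗ e_j in Δ(e_p).

module Over {c ℓ} (F : Field c ℓ) where
  open Field F using (Carrier; _≈_; _+_; _*_; 0#; 1#)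

  ∑ : ∀ {n} → (Fin n → Carrier) → Carrier
  ∑ {zero}  f = 0#
  ∑ {suc n} f = f Fin.zero + ∑ (λ i → f (Fin.suc i))

  δ : ∀ {n} → Fin n → Fin n → Carrier
  δ i j with does (i ≟ j)
  ... | true  = 1#
  ... | false = 0#

  ∑ₛ : ∀ n → (Vec Bool n → Carrier) → Carrier
  ∑ₛ zero    f = f []
  ∑ₛ (suc n) f = ∑ₛ n (λ P → f (true ∷ P)) + ∑ₛ n (λ P → f (false ∷ P))

  Mat : ℕ → ℕ → Set c
  Mat m n = Fin m → Fin n → Carrier

  record HopfData : Set c where
    field
      dim : ℕ → ℕ
      ρ   : ∀ {n} → Permutation′ n → Mat (dim n) (dim n)
      μ   : ∀ {k l n} → Lab k l n → Fin (dim n) → Fin (dim k) → Fin (dim l) → Carrier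
      Δ   : ∀ {k l n} → Lab k l n → Fin (dim k) → Fin (dim l) → Fin (dim n) → Carrier
      η   : Fin (dim 0) → Carrier                    -- unit   F → h[∅]   (image of 1)
      ε   : Fin (dim 0) → Carrier
      S   : ∀ {n} → Mat (dim n) (dim n)

    -- μ_{S,T} ∘ (id ⊗ s_T) ∘ Δ_{S,T}   and   μ_{S,T} ∘ (s_S ⊗ id) ∘ Δ_{S,T}
    convʳ : ∀ {n} → Decomp n → Mat (dim n) (dim n)
    convʳ (decomp k l τ) p q = ∑ λ i → ∑ λ j → ∑ λ j' → μ τ p i j * (S j j' * Δ τ i j' q)

    convˡ : ∀ {n} → Decomp n → Mat (dim n) (dim n)
    convˡ (decomp k l τ) p q = ∑ λ i → ∑ λ i' → ∑ λ j → μ τ p i j * (S i i' * Δ τ i' j q)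

    uε : ∀ n → Mat (dim n) (dim n)
    uε zero    p q = η p * ε q
    uε (suc n) p q = 0#

  record IsHopfMonoid (D : HopfData) : Set (c ⊔ ℓ) where
    open HopfData D
    field
      ρ-cong : ∀ {n} (σ π : Permutation′ n) → (∀ i → σ ⟨$⟩ʳ i ≡ π ⟨$⟩ʳ i) →
               ∀ p q → ρ σ p q ≈ ρ π p q
      ρ-id   : ∀ {n} p q → ρ (Perm.id {n}) p q ≈ δ p q
      ρ-∘    : ∀ {n} (σ π : Permutation′ n) p q →
               ρ (π ∘ₚ σ) p q ≈ ∑ (λ r → ρ σ p r * ρ π r q)
      -- naturality of μ and Δ (and independence of the chosen labelling):
      -- whenever  σ ∘ τ = τ' ∘ (α ⊎ β)
      μ-nat  : ∀ {k l n} (τ τ' : Lab k l n) (σ : Permutation′ n) (α : Permutation′ k) (β : Permutation′ l) →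
               (∀ x → σ ⟨$⟩ʳ Inverse.to τ x ≡ Inverse.to τ' (Sum.map (α ⟨$⟩ʳ_) (β ⟨$⟩ʳ_) x)) →
               ∀ p i j → ∑ (λ q → ρ σ p q * μ τ q i j) ≈ ∑ (λ i' → ∑ (λ j' → μ τ' p i' j' * (ρ α i' i * ρ β j' j)))
      Δ-nat  : ∀ {k l n} (τ τ' : Lab k l n) (σ : Permutation′ n) (α : Permutation′ k) (β : Permutation′ l) →
               (∀ x → σ ⟨$⟩ʳ Inverse.to τ x ≡ Inverse.to τ' (Sum.map (α ⟨$⟩ʳ_) (β ⟨$⟩ʳ_) x)) →
               ∀ i' j' p → ∑ (λ q → Δ τ' i' j' q * ρ σ q p) ≈ ∑ (λ i → ∑ (λ j → (ρ α i' i * ρ β j' j) * Δ τ i j p))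
      μ-assoc : ∀ {a b c n} (θ : (Fin a ⊎ (Fin b ⊎ Fin c)) ↔ Fin n) → ∀ p i j k →
                ∑ (λ q → μ (assocL θ) p q k * μ (std a b) q i j) ≈ ∑ (λ r → μ (assocR θ) p i r * μ (std b c) r j k)
      μ-unitˡ : ∀ {n} p j → ∑ (λ u → μ (unitˡ n) p u j * η u) ≈ δ p j
      μ-unitʳ : ∀ {n} p i → ∑ (λ u → μ (unitʳ n) p i u * η u) ≈ δ p i
      Δ-coassoc : ∀ {a b c n} (θ : (Fin a ⊎ (Fin b ⊎ Fin c)) ↔ Fin n) → ∀ i j k p →
                  ∑ (λ q → Δ (std a b) i j q * Δ (assocL θ) q k p) ≈ ∑ (λ r → Δ (std b c) j k r * Δ (assocR θ) i r p)
      Δ-counitˡ : ∀ {n} j p → ∑ (λ u → ε u * Δ (unitˡ n) u j p) ≈ δ j p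
      Δ-counitʳ : ∀ {n} i p → ∑ (λ u → ε u * Δ (unitʳ n) i u p) ≈ δ i p
      -- bimonoid compatibility:  Δ_{S',T'} μ_{S,T} = (μ_{A,C} ⊗ μ_{B,D}) (id ⊗ braid ⊗ id) (Δ_{A,B} ⊗ Δ_{C,D})
      compat : ∀ {a b c e n} (θ : ((Fin a ⊎ Fin b) ⊎ (Fin c ⊎ Fin e)) ↔ Fin n) → ∀ x y s t →
               ∑ (λ p → Δ (compat₂ θ) s t p * μ (compat₁ θ) p x y) ≈
               ∑ (λ i → ∑ (λ j → ∑ (λ k → ∑ (λ l →
                 (Δ (std a b) i j x * Δ (std c e) k l y) * (μ (std a c) s i k * μ (std b e) t j l)))))
      εη : ∑ (λ u → ε u * η u) ≈ 1#
      Δη : ∀ i j → ∑ (λ u → Δ (unitˡ 0) i j u * η u) ≈ η i * η j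
      εμ : ∀ i j → ∑ (λ u → ε u * μ (unitˡ 0) u i j) ≈ ε i * ε j
      S-nat : ∀ {n} (σ : Permutation′ n) p q → ∑ (λ r → ρ σ p r * S r q) ≈ ∑ (λ r → S p r * ρ σ r q)
      antipodeʳ : ∀ n p q → ∑ₛ n (λ P → convʳ (decompOf P) p q) ≈ uε n p q
      antipodeˡ : ∀ n p q → ∑ₛ n (λ P → convˡ (decompOf P) p q) ≈ uε n p q

  record HopfMonoid : Set (c ⊔ ℓ) where
    field
      hopfData : HopfData
      isHopfMonoid : IsHopfMonoid hopfData
    open HopfData hopfData public

  Connected : HopfMonoid → Set
  Connected h = HopfMonoid.dim h 0 ≡ 1

  supp : HopfMonoid → ℕ → Set
  supp h n = ¬ (HopfMonoid.dim h n ≡ 0)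

IsSubmonoidℕ : (ℕ → Set) → Set
IsSubmonoidℕ P = P 0 × (∀ m n → P m → P n → P (m ℕ.+ n))

module Submission where

-- 0 lies in the support because h[∅] = 𝔽.  For closure under addition let
-- x ∈ h[m] and y ∈ h[n] be basis vectors.  The compatibility axiom for the
-- decomposition [m] ⊔ ∅ ⊔ ∅ ⊔ [n] of a set of size m + n, combined with the
-- unit and counit axioms, says that  Δ_{m,n} ∘ μ_{m,n}  is the identity of
-- h[m] ⊗ h[n]; in particular its (x ⊗ y, x ⊗ y) matrix entry is 1.  That
-- entry is a sum over a basis of h[m + n], so if h[m + n] = 0 it is 0, and
-- 1 = 0 contradicts 𝔽 being a field.

open import Defs
open import Level using (Level)
open import Data.Nat using (zero; suc)
import Data.Nat as ℕ
import Data.Nat.Properties as ℕ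
open import Data.Fin using (Fin; toℕ)
import Data.Fin as Fin
open import Data.Fin.Properties using (toℕ-↑ˡ; toℕ-cast; toℕ-injective; subst-is-cast)
open import Data.Fin.Permutation using (_⟨$⟩ʳ_)
import Data.Fin.Permutation as Perm
open import Data.Sum using (_⊎_; inj₁; inj₂)
import Data.Sum as Sum
open import Data.Sum.Function.Propositional using (_⊎-↔_)
open import Data.Product using (_,_)
open import Function.Bundles using (_↔_; Inverse)
open import Function.Properties.Inverse using (↔-trans)
open import Relation.Nullary using (¬_)
open import Data.Empty using (⊥-elim)
import Relation.Binary.PropositionalEquality as P
open P using (_≡_)
import Algebra.Properties.CommutativeSemigroup as CommSemigroupProperties
import Algebra.Properties.Semiring.Sum as SemiringSum
import Relation.Binary.Reasoning.Setoid as SetoidReasoning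

element : ∀ {N} → ¬ N ≡ 0 → Fin N
element {zero}  N≢0 = ⊥-elim (N≢0 P.refl)
element {suc N} _   = Fin.zero

std-unitʳ : ∀ m (a : Fin m) → Inverse.to (std m 0) (inj₁ a) ≡ P.subst Fin (P.sym (ℕ.+-identityʳ m)) a
std-unitʳ m a = toℕ-injective (begin
  toℕ (a Fin.↑ˡ 0)      ≡⟨ toℕ-↑ˡ a 0 ⟩
  toℕ a                  ≡⟨ toℕ-cast e a ⟨
  toℕ (Fin.cast e a)     ≡⟨ P.cong toℕ (subst-is-cast e a) ⟨
  toℕ (P.subst Fin e a)  ∎)
  where
  open P.≡-Reasoning
  e = P.sym (ℕ.+-identityʳ m)

unitʳ-unique : ∀ {m} (τ : Lab m 0 m) → (∀ a → Inverse.to τ (inj₁ a) ≡ a) →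
               ∀ x → Inverse.to τ x ≡ Inverse.to (unitʳ m) x
unitʳ-unique τ τ≗id (inj₁ a) = τ≗id a
unitʳ-unique τ τ≗id (inj₂ ())

-- Pointwise equal labellings are related by identity permutations, in the
-- form demanded by the naturality axioms.
identity-relabelling : ∀ {k l n} (τ τ' : Lab k l n) → (∀ x → Inverse.to τ x ≡ Inverse.to τ' x) →
  ∀ x → Perm.id ⟨$⟩ʳ Inverse.to τ x ≡ Inverse.to τ' (Sum.map (Perm.id {k} ⟨$⟩ʳ_) (Perm.id {l} ⟨$⟩ʳ_) x)
identity-relabelling τ τ' τ≗τ' (inj₁ a) = τ≗τ' (inj₁ a)
identity-relabelling τ τ' τ≗τ' (inj₂ b) = τ≗τ' (inj₂ b)

module _ {c ℓ} (F : Field c ℓ) where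
  open Field F
  open Over F
  open SemiringSum semiring using (sum; sum-cong-≋; sum-replicate-zero; *-distribˡ-sum; *-distribʳ-sum)
  open CommSemigroupProperties *-commutativeSemigroup using (interchange; xy∙z≈y∙xz; xy∙z≈x∙zy)
  open SetoidReasoning setoid

  -- The sum ∑ of Defs is the library's sum, so its laws can be imported.
  ∑≡sum : ∀ {n} (f : Fin n → Carrier) → ∑ f ≡ sum f
  ∑≡sum {zero}  f = P.refl
  ∑≡sum {suc n} f = P.cong (f Fin.zero +_) (∑≡sum (λ i → f (Fin.suc i)))

  ∑-cong : ∀ {n} {f g : Fin n → Carrier} → (∀ i → f i ≈ g i) → ∑ f ≈ ∑ g
  ∑-cong {f = f} {g} f≈g = P.subst₂ _≈_ (P.sym (∑≡sum f)) (P.sym (∑≡sum g)) (sum-cong-≋ f≈g)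

  ∑-zero : ∀ {n} (f : Fin n → Carrier) → (∀ i → f i ≈ 0#) → ∑ f ≈ 0#
  ∑-zero {n} f f≈0 = trans (∑-cong f≈0) (P.subst (_≈ 0#) (P.sym (∑≡sum {n} (λ _ → 0#))) (sum-replicate-zero n))

  ∑-distribˡ : ∀ {n} x (f : Fin n → Carrier) → ∑ (λ i → x * f i) ≈ x * ∑ f
  ∑-distribˡ x f = P.subst₂ _≈_ (P.sym (∑≡sum (λ i → x * f i))) (P.cong (x *_) (P.sym (∑≡sum f))) (sym (*-distribˡ-sum x f))

  ∑-distribʳ : ∀ {n} x (f : Fin n → Carrier) → ∑ (λ i → f i * x) ≈ ∑ f * x
  ∑-distribʳ x f = P.subst₂ _≈_ (P.sym (∑≡sum (λ i → f i * x))) (P.cong (_* x) (P.sym (∑≡sum f))) (sym (*-distribʳ-sum x f))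

  ∑-product : ∀ {m n} (f : Fin m → Carrier) (g : Fin n → Carrier) →
              ∑ (λ i → ∑ (λ j → f i * g j)) ≈ ∑ f * ∑ g
  ∑-product f g = trans (∑-cong (λ i → ∑-distribˡ (f i) g)) (∑-distribʳ (∑ g) f)

  ∑-empty : ∀ {N} → N ≡ 0 → (f : Fin N → Carrier) → ∑ f ≈ 0#
  ∑-empty P.refl f = refl

  ∑-single : ∀ {N} → N ≡ 1 → (f : Fin N → Carrier) (u : Fin N) → ∑ f ≈ f u
  ∑-single P.refl f Fin.zero = +-identityʳ (f Fin.zero)

  δ-refl : ∀ {n} (p : Fin n) → δ p p ≈ 1#
  δ-refl Fin.zero    = refl
  δ-refl (Fin.suc p) = δ-refl p

  ∑-δˡ : ∀ {n} (p : Fin n) (f : Fin n → Carrier) → ∑ (λ q → δ p q * f q) ≈ f p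
  ∑-δˡ Fin.zero f =
    trans (+-cong (*-identityˡ _) (∑-zero _ (λ i → zeroˡ (f (Fin.suc i))))) (+-identityʳ _)
  ∑-δˡ (Fin.suc p) f =
    trans (+-cong (zeroˡ _) (∑-δˡ p (λ i → f (Fin.suc i)))) (+-identityˡ _)

  ∑-δʳ : ∀ {n} (p : Fin n) (f : Fin n → Carrier) → ∑ (λ q → f q * δ q p) ≈ f p
  ∑-δʳ Fin.zero f =
    trans (+-cong (*-identityʳ _) (∑-zero _ (λ i → zeroʳ (f (Fin.suc i))))) (+-identityʳ _)
  ∑-δʳ (Fin.suc p) f =
    trans (+-cong (zeroʳ _) (∑-δʳ p (λ i → f (Fin.suc i)))) (+-identityˡ _)

  ∑∑-δˡ : ∀ {m n} (a : Fin m) (b : Fin n) (f : Fin m → Fin n → Carrier) →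
          ∑ (λ i → ∑ (λ j → (δ a i * δ b j) * f i j)) ≈ f a b
  ∑∑-δˡ a b f = begin
    ∑ (λ i → ∑ (λ j → (δ a i * δ b j) * f i j)) ≈⟨ ∑-cong (λ i → ∑-cong (λ j → xy∙z≈y∙xz (δ a i) (δ b j) (f i j))) ⟩
    ∑ (λ i → ∑ (λ j → δ b j * (δ a i * f i j))) ≈⟨ ∑-cong (λ i → ∑-δˡ b (λ j → δ a i * f i j)) ⟩
    ∑ (λ i → δ a i * f i b)                     ≈⟨ ∑-δˡ a (λ i → f i b) ⟩
    f a b                                       ∎

  ∑∑-δʳ : ∀ {m n} (a : Fin m) (b : Fin n) (f : Fin m → Fin n → Carrier) →
          ∑ (λ i → ∑ (λ j → f i j * (δ i a * δ j b))) ≈ f a b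
  ∑∑-δʳ a b f = begin
    ∑ (λ i → ∑ (λ j → f i j * (δ i a * δ j b))) ≈⟨ ∑-cong (λ i → ∑-cong (λ j → sym (*-assoc (f i j) (δ i a) (δ j b)))) ⟩
    ∑ (λ i → ∑ (λ j → (f i j * δ i a) * δ j b)) ≈⟨ ∑-cong (λ i → ∑-δʳ b (λ j → f i j * δ i a)) ⟩
    ∑ (λ i → f i b * δ i a)                     ≈⟨ ∑-δʳ a (λ i → f i b) ⟩
    f a b                                       ∎

  -- If b·d is the column e_x and m·a the row e_xᵀ for scalars with b·a = 1,
  -- then the row times the column is 1.  This is the scalar shadow of the
  -- unit and counit axioms on a one-dimensional h[∅].
  ∑-δ-pairing : ∀ (a b : Carrier) → b * a ≈ 1# → ∀ {N} (x : Fin N) (d m : Fin N → Carrier) →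
                (∀ i → b * d i ≈ δ i x) → (∀ i → m i * a ≈ δ x i) → ∑ (λ i → d i * m i) ≈ 1#
  ∑-δ-pairing a b ba≈1 x d m bd≈δ ma≈δ = begin
    ∑ (λ i → d i * m i)           ≈⟨ ∑-cong (λ i → *-congʳ (d≈aδ i)) ⟩
    ∑ (λ i → (a * δ i x) * m i)   ≈⟨ ∑-cong (λ i → xy∙z≈x∙zy a (δ i x) (m i)) ⟩
    ∑ (λ i → a * (m i * δ i x))   ≈⟨ ∑-distribˡ a (λ i → m i * δ i x) ⟩
    a * ∑ (λ i → m i * δ i x)     ≈⟨ *-congˡ (∑-δʳ x m) ⟩
    a * m x                       ≈⟨ *-comm a (m x) ⟩
    m x * a                       ≈⟨ ma≈δ x ⟩
    δ x x                         ≈⟨ δ-refl x ⟩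
    1#                            ∎
    where
    d≈aδ : ∀ i → d i ≈ a * δ i x
    d≈aδ i = begin
      d i             ≈⟨ *-identityˡ (d i) ⟨
      1# * d i        ≈⟨ *-congʳ (trans (*-comm a b) ba≈1) ⟨
      (a * b) * d i   ≈⟨ *-assoc a b (d i) ⟩
      a * (b * d i)   ≈⟨ *-congˡ (bd≈δ i) ⟩
      a * δ i x       ∎

  module Bimonoid (h : HopfMonoid) where
    open HopfMonoid h
    open IsHopfMonoid isHopfMonoid

    -- μ and Δ depend only on the labelling function, not on the proof that it is
    -- a bijection: naturality with all permutations the identity.
    Δ-labelling : ∀ {k l n} (τ τ' : Lab k l n) → (∀ x → Inverse.to τ x ≡ Inverse.to τ' x) →
                  ∀ i j p → Δ τ i j p ≈ Δ τ' i j p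
    Δ-labelling τ τ' τ≗τ' i j p = begin
      Δ τ i j p
        ≈⟨ ∑∑-δˡ i j (λ i' j' → Δ τ i' j' p) ⟨
      ∑ (λ i' → ∑ (λ j' → (δ i i' * δ j j') * Δ τ i' j' p))
        ≈⟨ ∑-cong (λ i' → ∑-cong (λ j' → *-congʳ (*-cong (ρ-id i i') (ρ-id j j')))) ⟨
      ∑ (λ i' → ∑ (λ j' → (ρ Perm.id i i' * ρ Perm.id j j') * Δ τ i' j' p))
        ≈⟨ Δ-nat τ τ' Perm.id Perm.id Perm.id (identity-relabelling τ τ' τ≗τ') i j p ⟨
      ∑ (λ q → Δ τ' i j q * ρ Perm.id q p)
        ≈⟨ ∑-cong (λ q → *-congˡ (ρ-id q p)) ⟩
      ∑ (λ q → Δ τ' i j q * δ q p)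
        ≈⟨ ∑-δʳ p (Δ τ' i j) ⟩
      Δ τ' i j p ∎

    μ-labelling : ∀ {k l n} (τ τ' : Lab k l n) → (∀ x → Inverse.to τ x ≡ Inverse.to τ' x) →
                  ∀ p i j → μ τ p i j ≈ μ τ' p i j
    μ-labelling τ τ' τ≗τ' p i j = begin
      μ τ p i j
        ≈⟨ ∑-δˡ p (λ q → μ τ q i j) ⟨
      ∑ (λ q → δ p q * μ τ q i j)
        ≈⟨ ∑-cong (λ q → *-congʳ (ρ-id p q)) ⟨
      ∑ (λ q → ρ Perm.id p q * μ τ q i j)
        ≈⟨ μ-nat τ τ' Perm.id Perm.id Perm.id (identity-relabelling τ τ' τ≗τ') p i j ⟩
      ∑ (λ i' → ∑ (λ j' → μ τ' p i' j' * (ρ Perm.id i' i * ρ Perm.id j' j)))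
        ≈⟨ ∑-cong (λ i' → ∑-cong (λ j' → *-congˡ (*-cong (ρ-id i' i) (ρ-id j' j)))) ⟩
      ∑ (λ i' → ∑ (λ j' → μ τ' p i' j' * (δ i' i * δ j' j)))
        ≈⟨ ∑∑-δʳ i j (μ τ' p) ⟩
      μ τ' p i j ∎

    -- The right (co)unit axioms hold for any labelling [m] ⊔ ∅ ≅ [K] that is the
    -- identity on [m] up to an equation K ≡ m; we need K = m + 0.
    Δ-counitʳ-along : ∀ {m K} (e : K ≡ m) (τ : Lab m 0 K) →
      (∀ a → Inverse.to τ (inj₁ a) ≡ P.subst Fin (P.sym e) a) →
      ∀ i p → ∑ (λ u → ε u * Δ τ i u p) ≈ δ i (P.subst (λ k → Fin (dim k)) e p)
    Δ-counitʳ-along P.refl τ τ≗id i p =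
      trans (∑-cong (λ u → *-congˡ (Δ-labelling τ (unitʳ _) (unitʳ-unique τ τ≗id) i u p))) (Δ-counitʳ i p)

    μ-unitʳ-along : ∀ {m K} (e : K ≡ m) (τ : Lab m 0 K) →
      (∀ a → Inverse.to τ (inj₁ a) ≡ P.subst Fin (P.sym e) a) →
      ∀ p i → ∑ (λ u → μ τ p i u * η u) ≈ δ (P.subst (λ k → Fin (dim k)) e p) i
    μ-unitʳ-along P.refl τ τ≗id p i =
      trans (∑-cong (λ u → *-congʳ (μ-labelling τ (unitʳ _) (unitʳ-unique τ τ≗id) p i u))) (μ-unitʳ p i)

    module Connected (conn : dim 0 ≡ 1) where
      u₀ : Fin (dim 0)
      u₀ = P.subst Fin (P.sym conn) Fin.zero

      ∑₀ : (f : Fin (dim 0) → Carrier) → ∑ f ≈ f u₀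
      ∑₀ f = ∑-single conn f u₀

      η₀ ε₀ : Carrier
      η₀ = η u₀
      ε₀ = ε u₀

      ε₀η₀≈1 : ε₀ * η₀ ≈ 1#
      ε₀η₀≈1 = trans (sym (∑₀ (λ u → ε u * η u))) εη

      Δ-counitˡ₀ : ∀ {n} j p → ε₀ * Δ (std 0 n) u₀ j p ≈ δ j p
      Δ-counitˡ₀ {n} j p = trans (sym (∑₀ (λ u → ε u * Δ (unitˡ n) u j p))) (Δ-counitˡ j p)

      μ-unitˡ₀ : ∀ {n} p j → μ (std 0 n) p u₀ j * η₀ ≈ δ p j
      μ-unitˡ₀ {n} p j = trans (sym (∑₀ (λ u → μ (unitˡ n) p u j * η u))) (μ-unitˡ p j)

      drop+0 : ∀ m → Fin (dim (m ℕ.+ 0)) → Fin (dim m)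
      drop+0 m = P.subst (λ k → Fin (dim k)) (ℕ.+-identityʳ m)

      Δ-counitʳ₀ : ∀ {m} i p → ε₀ * Δ (std m 0) i u₀ p ≈ δ i (drop+0 m p)
      Δ-counitʳ₀ {m} i p = trans (sym (∑₀ (λ u → ε u * Δ (std m 0) i u p)))
                                 (Δ-counitʳ-along (ℕ.+-identityʳ m) (std m 0) (std-unitʳ m) i p)

      μ-unitʳ₀ : ∀ {m} p i → μ (std m 0) p i u₀ * η₀ ≈ δ (drop+0 m p) i
      μ-unitʳ₀ {m} p i = trans (sym (∑₀ (λ u → μ (std m 0) p i u * η u)))
                               (μ-unitʳ-along (ℕ.+-identityʳ m) (std m 0) (std-unitʳ m) p i)

      -- The diagonal entries of Δ_{m,n} ∘ μ_{m,n} (in fact the identity) are 1.  The compatibility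
      -- axiom for [m] ⊔ ∅ ⊔ ∅ ⊔ [n] factors the entry into a counit-unit pairing
      -- on each of the two blocks.
      Δμ-diagonal : ∀ {m n N} (θ : ((Fin m ⊎ Fin 0) ⊎ (Fin 0 ⊎ Fin n)) ↔ Fin N) x y →
                    ∑ (λ p → Δ (compat₂ θ) x y p * μ (compat₁ θ) p x y) ≈ 1#
      Δμ-diagonal {m} {n} θ x y = begin
        ∑ (λ p → Δ (compat₂ θ) x y p * μ (compat₁ θ) p x y)
          ≈⟨ compat θ x y x y ⟩
        ∑ (λ i → ∑ (λ j → ∑ (λ k → ∑ (λ l → term i j k l))))
          ≈⟨ ∑-cong (λ i → trans (∑₀ (λ j → ∑ (λ k → ∑ (term i j k))))
                                 (∑₀ (λ k → ∑ (term i u₀ k)))) ⟩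
        ∑ (λ i → ∑ (λ l → (Δᵐ i * Δⁿ l) * (μᵐ i * μⁿ l)))
          ≈⟨ ∑-cong (λ i → ∑-cong (λ l → interchange (Δᵐ i) (Δⁿ l) (μᵐ i) (μⁿ l))) ⟩
        ∑ (λ i → ∑ (λ l → (Δᵐ i * μᵐ i) * (Δⁿ l * μⁿ l)))
          ≈⟨ ∑-product (λ i → Δᵐ i * μᵐ i) (λ l → Δⁿ l * μⁿ l) ⟩
        ∑ (λ i → Δᵐ i * μᵐ i) * ∑ (λ l → Δⁿ l * μⁿ l)
          ≈⟨ *-cong (∑-δ-pairing η₀ ε₀ ε₀η₀≈1 (drop+0 m x) Δᵐ μᵐ (λ i → Δ-counitʳ₀ i x) (μ-unitʳ₀ x))
                    (∑-δ-pairing η₀ ε₀ ε₀η₀≈1 y Δⁿ μⁿ (λ l → Δ-counitˡ₀ l y) (μ-unitˡ₀ y)) ⟩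
        1# * 1#
          ≈⟨ *-identityˡ 1# ⟩
        1# ∎
        where
        term : Fin (dim m) → Fin (dim 0) → Fin (dim 0) → Fin (dim n) → Carrier
        term i j k l = (Δ (std m 0) i j x * Δ (std 0 n) k l y) * (μ (std m 0) x i k * μ (std 0 n) y j l)
        Δᵐ μᵐ : Fin (dim m) → Carrier
        Δᵐ i = Δ (std m 0) i u₀ x
        μᵐ i = μ (std m 0) x i u₀
        Δⁿ μⁿ : Fin (dim n) → Carrier
        Δⁿ l = Δ (std 0 n) u₀ l y
        μⁿ l = μ (std 0 n) y u₀ l

      -- Hence h[m + n] ≠ 0 whenever h[m] ≠ 0 ≠ h[n]: a diagonal entry 1 of a
      -- matrix factoring through h[m + n] = 0 would force 1 = 0 in 𝔽.
      support-closed : ∀ m n → ¬ dim m ≡ 0 → ¬ dim n ≡ 0 → ¬ dim (m ℕ.+ n) ≡ 0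
      support-closed m n h[m]≢0 h[n]≢0 h[m+n]≡0 = 1≉0 (begin
        1#                                                   ≈⟨ Δμ-diagonal θ x y ⟨
        ∑ (λ p → Δ (compat₂ θ) x y p * μ (compat₁ θ) p x y) ≈⟨ ∑-empty h[m+n]≡0 _ ⟩
        0#                                                   ∎)
        where
        θ : ((Fin m ⊎ Fin 0) ⊎ (Fin 0 ⊎ Fin n)) ↔ Fin (m ℕ.+ n)
        θ = ↔-trans (unitʳ m ⊎-↔ unitˡ n) (std m n)
        x : Fin (dim (m ℕ.+ 0))
        x = element (P.subst (λ k → ¬ dim k ≡ 0) (P.sym (ℕ.+-identityʳ m)) h[m]≢0)
        y : Fin (dim n)
        y = element h[n]≢0

corollary4p4 : ∀ {c ℓ : Level} (F : Field c ℓ) (h : Over.HopfMonoid F) →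
    Over.Connected F h → IsSubmonoidℕ (Over.supp F h)
corollary4p4 F h conn = h[∅]≢0 , Bimonoid.Connected.support-closed F h conn
  where
  h[∅]≢0 : Over.supp F h 0
  h[∅]≢0 h[∅]≡0 = ℕ.1+n≢0 (P.trans (P.sym conn) h[∅]≡0)
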